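{- Let $S$ be a string and suppose there are nodes $u, v, u', v'$ of $\mathsf{CPH}(S)$ with reversed suffix links $\mathsf{rsl}(v,a) = u$ and $\mathsf{rsl}(v',a') = u'$ such that $v'$ is the parent of $v$ and $u'$ is the parent of $u$. Then $0 \le a - a' \le 1$.
   Context: $\mathsf{PD}(X)[i] = i - \max\{j<i : X[j]\le X[i]\}$ if such $j$ exists and $0$ otherwise; $S[i..]=S[i..|S|]$. Sequence hash tree $\mathsf{SHT}(\langle w_1,\ldots,w_k\rangle)$: the trie (nodes identified with their root-to-node path labels) built from a root by adding, for $i=1,\ldots,k$, the node $w_i[1..|p_i|+1]$ as a child (edge label $w_i[|p_i|+1]$) of the longest prefix $p_i$ of $w_i$ already present. For $|S|=n$, $\mathsf{CPH}(S) = \mathsf{SHT}(\langle \mathsf{PD}(S[n..]),\ldots,\mathsf{PD}(S[1..])\rangle)$. A position $f$ of an integer sequence $u$ is a front pointer if $f\ge2$ and $f-u[f]=1$; $\mathcal{F}_u$ is the set of front pointers. For a non-root node $u$, $\mathsf{sl}(u)$ is obtained from $u$ by replacing $u[f]$ by $0$ for every $f\in\mathcal{F}_u$ and removing the first entry $u[1]$. $\mathsf{rsl}(v,a) = u$ iff $\mathsf{sl}(u)=v$ and $a = |\mathcal{F}_u|$. -}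

module Defs where

open import Data.Nat using (ℕ; zero; suc; _≤ᵇ_; _<ᵇ_; _≡ᵇ_; _⊔_)
open import Data.Bool using (Bool; true; false; if_then_else_)
open import Data.List using (List; []; _∷_; _++_; [_]; length; take; reverse; foldl)
open import Data.List.Properties using (≡-dec)
open import Data.Nat.Properties using (_≟_)
open import Relation.Nullary using (does)
open import Relation.Binary.PropositionalEquality using (_≡_)

-- Strings over a totally ordered alphabet, represented by ℕ.
String : Set
String = List ℕ

-- Distance (1-based) from the end of a list to the nearest element ≤ x,
-- scanning the list given in reverse order (nearest first); 0 if none.
nearestLeq : List ℕ → ℕ → ℕ
nearestLeq []       x = 0
nearestLeq (y ∷ ys) x with y ≤ᵇ x
... | true  = 1
... | false with nearestLeq ys x
...   | zero  = 0
...   | suc d = suc (suc d)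

-- PD(X)[i] = i - max{ j < i : X[j] ≤ X[i] }, or 0 if no such j.
-- 'pre' holds X[1..i-1] in reverse order.
PDgo : List ℕ → List ℕ → List ℕ
PDgo pre []       = []
PDgo pre (x ∷ xs) = nearestLeq pre x ∷ PDgo (x ∷ pre) xs

PD : List ℕ → List ℕ
PD = PDgo []

suffixes : String → List String
suffixes []       = []
suffixes (x ∷ xs) = (x ∷ xs) ∷ suffixes xs

memb : List ℕ → List (List ℕ) → Bool
memb w []       = false
memb w (v ∷ vs) = if does (≡-dec _≟_ w v) then true else memb w vs

lppUpTo : List (List ℕ) → List ℕ → ℕ → ℕ
lppUpTo N w zero    = 0
lppUpTo N w (suc k) = if memb (take (suc k) w) N then suc k else lppUpTo N w k

lpp : List (List ℕ) → List ℕ → ℕ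
lpp N w = lppUpTo N w (length w)

shtInsert : List (List ℕ) → List ℕ → List (List ℕ)
shtInsert N w with lpp N w <ᵇ length w
... | true  = N ++ [ take (suc (lpp N w)) w ]
... | false = N

SHT : List (List ℕ) → List (List ℕ)
SHT ws = foldl shtInsert ([] ∷ []) ws

CPH : String → List (List ℕ)
CPH S = SHT (reverse (Data.List.map PD (suffixes S)))

_∈CPH_ : List ℕ → String → Set
u ∈CPH S = memb u (CPH S) ≡ true

-- Front pointers: 1-based position f ≥ 2 with f - u[f] = 1, i.e. u[f] = f - 1.
-- For the tail of u, entry at 0-based index k has position f = k + 2.
isFP : ℕ → ℕ → Bool
isFP k x = x ≡ᵇ suc k

slTail : ℕ → List ℕ → List ℕ
slTail k []       = []
slTail k (x ∷ xs) = (if isFP k x then 0 else x) ∷ slTail (suc k) xs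

countFPTail : ℕ → List ℕ → ℕ
countFPTail k []       = 0
countFPTail k (x ∷ xs) = (if isFP k x then 1 else 0) Data.Nat.+ countFPTail (suc k) xs

numFP : List ℕ → ℕ
numFP []       = 0
numFP (_ ∷ xs) = countFPTail 0 xs

-- sl(u): zero out front pointers, drop first entry (only meaningful for u non-root)
sl : List ℕ → List ℕ
sl []       = []
sl (_ ∷ xs) = slTail 0 xs

-- The front pointers of u' ∷ʳ c are those of u' together with possibly the new
-- last position, so appending one entry raises |F| by 0 or 1.
module Submission where

open import Defs
open import Data.Nat using (ℕ; suc; _≤_; _+_; z≤n; s≤s)
open import Data.Nat.Properties using (+-identityʳ; +-assoc; +-suc; +-comm; m≤m+n; +-monoˡ-≤; module ≤-Reasoning)
open import Data.Bool using (true; false; if_then_else_)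
open import Data.List using (List; []; _∷_; _∷ʳ_; length)
open import Data.Product using (_×_; ∃; _,_)
open import Relation.Binary.PropositionalEquality
  using (_≡_; _≢_; refl; cong; module ≡-Reasoning)

fpIndicator : ℕ → ℕ → ℕ
fpIndicator k x = if isFP k x then 1 else 0

fpIndicator≤1 : ∀ k x → fpIndicator k x ≤ 1
fpIndicator≤1 k x with isFP k x
... | true  = s≤s z≤n
... | false = z≤n

countFPTail-∷ʳ : ∀ k xs c →
  countFPTail k (xs ∷ʳ c) ≡ countFPTail k xs + fpIndicator (k + length xs) c
countFPTail-∷ʳ k []       c = begin
  fpIndicator k c + 0        ≡⟨ +-identityʳ _ ⟩
  fpIndicator k c            ≡⟨ cong (λ i → fpIndicator i c) (+-identityʳ k) ⟨
  fpIndicator (k + 0) c      ∎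
  where open ≡-Reasoning
countFPTail-∷ʳ k (x ∷ xs) c = begin
  fpIndicator k x + countFPTail (suc k) (xs ∷ʳ c)
    ≡⟨ cong (fpIndicator k x +_) (countFPTail-∷ʳ (suc k) xs c) ⟩
  fpIndicator k x + (countFPTail (suc k) xs + fpIndicator (suc k + length xs) c)
    ≡⟨ +-assoc (fpIndicator k x) _ _ ⟨
  countFPTail k (x ∷ xs) + fpIndicator (suc k + length xs) c
    ≡⟨ cong (λ i → countFPTail k (x ∷ xs) + fpIndicator i c) (+-suc k (length xs)) ⟨
  countFPTail k (x ∷ xs) + fpIndicator (k + length (x ∷ xs)) c
    ∎
  where open ≡-Reasoning

numFP-∷ʳ : ∀ x xs c → numFP ((x ∷ xs) ∷ʳ c) ≡ numFP (x ∷ xs) + fpIndicator (length xs) c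
numFP-∷ʳ x xs c = countFPTail-∷ʳ 0 xs c

numFP-∷ʳ-bounds : ∀ u c → numFP u ≤ numFP (u ∷ʳ c) × numFP (u ∷ʳ c) ≤ suc (numFP u)
numFP-∷ʳ-bounds []       c = z≤n , z≤n
numFP-∷ʳ-bounds (x ∷ xs) c rewrite numFP-∷ʳ x xs c = m≤m+n n b , n+b≤1+n
  where
    open ≤-Reasoning
    n = numFP (x ∷ xs)
    b = fpIndicator (length xs) c
    n+b≤1+n : n + b ≤ suc n
    n+b≤1+n = begin
      n + b  ≡⟨ +-comm n b ⟩
      b + n  ≤⟨ +-monoˡ-≤ n (fpIndicator≤1 (length xs) c) ⟩
      1 + n  ∎

lemma5 : (S : String) (u v u' v' : List ℕ) (a a' : ℕ) →
    u ∈CPH S → v ∈CPH S → u' ∈CPH S → v' ∈CPH S →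
    u ≢ [] → sl u ≡ v → a ≡ numFP u →
    u' ≢ [] → sl u' ≡ v' → a' ≡ numFP u' →
    ∃ (λ c → v ≡ v' ∷ʳ c) → ∃ (λ c → u ≡ u' ∷ʳ c) →
    a' ≤ a × a ≤ suc a'
lemma5 _ _ _ u' _ _ _ _ _ _ _ _ _ refl _ _ refl _ (c , refl) = numFP-∷ʳ-bounds u' c
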